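{- For each non-negative integer $n$, there is, up to isomorphism, a unique binary projective target with exactly $n$ elements.
   Context: Write $P_r$ for $PG(r-1,2)$. For a subset $G$ of $E(P_r)$ let $R=E(P_r)-G$. The matroid $P_r|G$ is a (binary) projective target if there is a chain of flats $F_0\subseteq F_1\subseteq\cdots\subseteq F_r$ of $P_r$ with $r(F_j)=j$ for all $j$ such that for each $i\in\{1,\dots,r\}$ the set $F_i-F_{i-1}$ is contained in $G$ or contained in $R$. -}

module Defs where

open import Data.Nat using (ℕ; zero; suc)
open import Data.Bool using (Bool; true; false; _xor_; _∨_; if_then_else_; T)
open import Data.Vec using (Vec; []; _∷_; replicate; zipWith; map; foldr)
open import Data.Fin using (Fin; inject₁) renaming (suc to fsuc)
open import Data.Product using (Σ; ∃; _×_; proj₁)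
open import Data.Sum using (_⊎_)
open import Relation.Nullary using (¬_)
open import Relation.Binary.PropositionalEquality using (_≡_)
open import Function.Bundles using (_↔_; _⇔_; Inverse)

V : ℕ → Set
V r = Vec Bool r

zeroV : ∀ {r} → V r
zeroV = replicate _ false

_⊕_ : ∀ {r} → V r → V r → V r
_⊕_ = zipWith _xor_

nonzero : ∀ {r} → V r → Bool
nonzero = foldr _ _∨_ false

-- E(P_r): the points of PG(r-1,2) = nonzero vectors of GF(2)^r.
Point : ℕ → Set
Point r = Σ (V r) (λ v → T (nonzero v))

Subset : ℕ → Set
Subset r = Point r → Bool

lc : ∀ {r m} → Vec Bool m → Vec (V r) m → V r
lc [] [] = zeroV
lc (c ∷ cs) (x ∷ xs) = (if c then x else zeroV) ⊕ lc cs xs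

Indep : ∀ {r m} → Vec (V r) m → Set
Indep {r} {m} xs = ∀ (cs : Vec Bool m) → lc cs xs ≡ zeroV → cs ≡ replicate m false

InSpan : ∀ {r m} → Vec (V r) m → V r → Set
InSpan {r} {m} xs v = ∃ λ (cs : Vec Bool m) → lc cs xs ≡ v

-- F is a flat of P_r of rank j: F = cl(B) for an independent set B of size j
-- (in P_r, cl(B) = span(B) - {0}).
IsFlatOfRank : ∀ r → Subset r → ℕ → Set
IsFlatOfRank r F j =
  Σ (Vec (Point r) j) λ B →
    Indep (map proj₁ B) × (∀ (p : Point r) → (T (F p) ⇔ InSpan (map proj₁ B) (proj₁ p)))

_⊆_ : ∀ {r} → Subset r → Subset r → Set
_⊆_ {r} A B = ∀ (p : Point r) → T (A p) → T (B p)

IsProjectiveTarget : ∀ r → Subset r → Set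
IsProjectiveTarget r G =
  Σ (Fin (suc r) → Subset r) λ F →
      (∀ (j : Fin (suc r)) → IsFlatOfRank r (F j) (Data.Fin.toℕ j))
    × (∀ (i : Fin r) → F (inject₁ i) ⊆ F (fsuc i))
    × (∀ (i : Fin r) →
         (∀ (p : Point r) → T (F (fsuc i) p) → ¬ T (F (inject₁ i) p) → T (G p))
       ⊎ (∀ (p : Point r) → T (F (fsuc i) p) → ¬ T (F (inject₁ i) p) → ¬ T (G p)))

Elem : ∀ {r} → Subset r → Set
Elem {r} G = Σ (Point r) (λ p → T (G p))

vec : ∀ {r} {G : Subset r} → Elem G → V r
vec e = proj₁ (proj₁ e)

HasSize : ∀ {r} → Subset r → ℕ → Set
HasSize G n = Elem G ↔ Fin n

Isomorphic : ∀ r (G : Subset r) s (H : Subset s) → Set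
Isomorphic r G s H =
  Σ (Elem G ↔ Elem H) λ φ →
    ∀ (m : ℕ) (xs : Vec (Elem G) m) →
      Indep (map vec xs) ⇔ Indep (map (λ x → vec (Inverse.to φ x)) xs)

{-# OPTIONS --safe #-}
-- Pick b₁, …, b_r with b_k ∈ F_k − F_{k−1}. In the coordinates of this basis a point lies in
-- F_k − F_{k−1} exactly when its leading nonzero coordinate is the k-th, so every projective
-- target is linearly isomorphic to a canonical one, determined by the word σ of layer colours.
-- Layer k has 2^(k−1) points, so the canonical target of σ has as many elements as the number
-- with binary digits σ, and two words with the same value differ only by leading zeros, which
-- do not change the matroid. Hence the targets of size n all correspond to the binary
-- representation of n.
module Submission where

open import Defs
open import Level using (0ℓ)
open import Algebra.Bundles using (AbelianGroup)
import Algebra.Properties.AbelianGroup as AbelianGroupProperties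
import Algebra.Properties.CommutativeSemigroup as CommutativeSemigroupProperties
open import Data.Nat
  using (ℕ; zero; suc; _+_; _∸_; _^_; _<_; _≤_; z≤n; s≤s; _≤′_; ≤′-refl; ≤′-step; _≡ᵇ_; _≤ᵇ_)
import Data.Nat.Properties as ℕ
open import Data.Bool as Bool using (Bool; true; false; _xor_; if_then_else_; T; T?)
open import Data.Bool.Properties
  using (xor-assoc; xor-comm; xor-identityˡ; xor-identityʳ; xor-same; T-irrelevant; T-≡)
open import Data.Vec using (Vec; []; _∷_; replicate; map; lookup; tabulate)
open import Data.Vec.Properties
  using ( zipWith-assoc; zipWith-comm; zipWith-identityˡ; zipWith-identityʳ; ∷-injectiveˡ; ∷-injectiveʳ
        ; ≡-dec; tabulate-∘; tabulate-cong; tabulate∘lookup; lookup-map; map-∘; map-cong)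
open import Data.Fin using (Fin; zero; suc; toℕ; inject₁)
open import Data.Fin.Properties
  using (toℕ<n; toℕ-inject₁; 2↔Bool; *↔×; +↔⊎; injective⇒≤; all?; ¬∀⟶∃¬)
open import Data.Fin.Permutation using (↔⇒≡)
open import Data.Product using (Σ; ∃; _×_; _,_; proj₁; proj₂)
open import Data.Product.Function.NonDependent.Propositional using (_×-↔_)
open import Data.Sum using (_⊎_; inj₁; inj₂)
open import Data.Sum.Function.Propositional using (_⊎-↔_)
open import Data.Empty using (⊥-elim)
open import Data.Unit using (tt)
open import Function
  using (id; _∘_; _↔_; _⇔_; _↣_; mk↔ₛ′; mk⇔; mk↣; Equivalence; Inverse; Injection; Injective)
open import Function.Properties.Inverse using (↔⇒↣)
open import Function.Construct.Composition using (_↔-∘_; _↣-∘_; _⇔-∘_)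
open import Function.Construct.Identity using (↔-id; ⇔-id)
open import Function.Construct.Symmetry using (↔-sym; ⇔-sym)
open import Relation.Nullary using (¬_; Dec; yes; no; contradiction)
open import Relation.Nullary.Decidable using (map′)
open import Relation.Binary using (tri<; tri≈; tri>)
open import Relation.Binary.PropositionalEquality

⊕-self : ∀ {r} (v : V r) → v ⊕ v ≡ zeroV
⊕-self []      = refl
⊕-self (x ∷ v) = cong₂ _∷_ (xor-same x) (⊕-self v)

⊕-abelianGroup : ℕ → AbelianGroup 0ℓ 0ℓ
⊕-abelianGroup r = record
  { Carrier = V r ; _≈_ = _≡_ ; _∙_ = _⊕_ ; ε = zeroV ; _⁻¹ = id
  ; isAbelianGroup = record
    { isGroup = record
      { isMonoid = record
        { isSemigroup = record
          { isMagma = record { isEquivalence = isEquivalence ; ∙-cong = cong₂ _⊕_ }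
          ; assoc   = zipWith-assoc xor-assoc }
        ; identity = zipWith-identityˡ xor-identityˡ , zipWith-identityʳ xor-identityʳ }
      ; inverse = ⊕-self , ⊕-self
      ; ⁻¹-cong = id }
    ; comm = zipWith-comm xor-comm } }

module _ {r : ℕ} where
  open AbelianGroup (⊕-abelianGroup r) using (identityˡ; identityʳ; commutativeSemigroup)
  open AbelianGroupProperties (⊕-abelianGroup r) using (\\-leftDividesˡ; //-rightDividesʳ; inverseˡ-unique)
  open CommutativeSemigroupProperties commutativeSemigroup using (interchange)

  ⊕-identityˡ : (v : V r) → zeroV ⊕ v ≡ v
  ⊕-identityˡ = identityˡ

  ⊕-identityʳ : (v : V r) → v ⊕ zeroV ≡ v
  ⊕-identityʳ = identityʳ

  ⊕-cancelˡ : (u v : V r) → u ⊕ (u ⊕ v) ≡ v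
  ⊕-cancelˡ = \\-leftDividesˡ

  ⊕-cancelʳ : (u v : V r) → (v ⊕ u) ⊕ u ≡ v
  ⊕-cancelʳ = //-rightDividesʳ

  ⊕≡zero⇒≡ : (u v : V r) → u ⊕ v ≡ zeroV → u ≡ v
  ⊕≡zero⇒≡ = inverseˡ-unique

  ⊕-interchange : (a b c d : V r) → (a ⊕ b) ⊕ (c ⊕ d) ≡ (a ⊕ c) ⊕ (b ⊕ d)
  ⊕-interchange = interchange

infix 21 _·_
_·_ : ∀ {r} → Bool → V r → V r
c · x = if c then x else zeroV

·-distrib-xor : ∀ {r} (a b : Bool) (x : V r) → (a xor b) · x ≡ a · x ⊕ b · x
·-distrib-xor false b x = sym (⊕-identityˡ (b · x))
·-distrib-xor true false x = sym (⊕-identityʳ x)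
·-distrib-xor true true x = sym (⊕-self x)

lc-zero : ∀ {r m} (xs : Vec (V r) m) → lc (replicate m false) xs ≡ zeroV
lc-zero []       = refl
lc-zero (x ∷ xs) = trans (⊕-identityˡ _) (lc-zero xs)

lc-⊕ : ∀ {r m} (c d : Vec Bool m) (xs : Vec (V r) m) → lc (c ⊕ d) xs ≡ lc c xs ⊕ lc d xs
lc-⊕ []      []      []       = sym (⊕-self zeroV)
lc-⊕ (a ∷ c) (b ∷ d) (x ∷ xs) = begin
  (a xor b) · x ⊕ lc (c ⊕ d) xs          ≡⟨ cong₂ _⊕_ (·-distrib-xor a b x) (lc-⊕ c d xs) ⟩
  (a · x ⊕ b · x) ⊕ (lc c xs ⊕ lc d xs)  ≡⟨ ⊕-interchange _ _ _ _ ⟩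
  (a · x ⊕ lc c xs) ⊕ (b · x ⊕ lc d xs)  ∎
  where open ≡-Reasoning

lc-∘ : ∀ {r k m} (c : Vec Bool m) (ds : Vec (V k) m) (ys : Vec (V r) k) →
       lc (lc c ds) ys ≡ lc c (map (λ d → lc d ys) ds)
lc-∘ []      []       ys = lc-zero ys
lc-∘ (a ∷ c) (d ∷ ds) ys = trans (lc-⊕ (a · d) (lc c ds) ys) (cong₂ _⊕_ (scaled a) (lc-∘ c ds ys))
  where
  scaled : ∀ a → lc (a · d) ys ≡ a · lc d ys
  scaled false = lc-zero ys
  scaled true  = refl

lc-map-false∷ : ∀ {r m} (c : Vec Bool m) (xs : Vec (V r) m) →
                lc c (map (false ∷_) xs) ≡ false ∷ lc c xs
lc-map-false∷ []          []       = refl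
lc-map-false∷ (false ∷ c) (x ∷ xs) = cong (false · (false ∷ x) ⊕_) (lc-map-false∷ c xs)
lc-map-false∷ (true ∷ c)  (x ∷ xs) = cong (true · (false ∷ x) ⊕_) (lc-map-false∷ c xs)

std : ∀ r → Vec (V r) r
std zero    = []
std (suc r) = (true ∷ zeroV) ∷ map (false ∷_) (std r)

lc-std : ∀ {r} (c : V r) → lc c (std r) ≡ c
lc-std []              = refl
lc-std {suc r} (x ∷ c) = begin
  x · e₁ ⊕ lc c (map (false ∷_) (std r))  ≡⟨ cong (x · e₁ ⊕_) (lc-map-false∷ c (std r)) ⟩
  x · e₁ ⊕ (false ∷ lc c (std r))         ≡⟨ cong (λ w → x · e₁ ⊕ (false ∷ w)) (lc-std c) ⟩
  x · e₁ ⊕ (false ∷ c)                    ≡⟨ leading x ⟩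
  x ∷ c                                   ∎
  where
  open ≡-Reasoning
  e₁ = true ∷ zeroV
  leading : ∀ x → x · e₁ ⊕ (false ∷ c) ≡ x ∷ c
  leading false = cong (false ∷_) (⊕-identityˡ c)
  leading true  = cong (true ∷_) (⊕-identityˡ c)

nonzero⇒≢zero : ∀ {r} (v : V r) → T (nonzero v) → v ≢ zeroV
nonzero⇒≢zero (true ∷ v)  _  ()
nonzero⇒≢zero (false ∷ v) nz e = nonzero⇒≢zero v nz (∷-injectiveʳ e)

≢zero⇒nonzero : ∀ {r} (v : V r) → v ≢ zeroV → T (nonzero v)
≢zero⇒nonzero []          ne = ne refl
≢zero⇒nonzero (true ∷ v)  _  = tt
≢zero⇒nonzero (false ∷ v) ne = ≢zero⇒nonzero v (ne ∘ cong (false ∷_))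

¬nonzero-zeroV : ∀ r → ¬ T (nonzero (zeroV {r}))
¬nonzero-zeroV r nz = nonzero⇒≢zero (zeroV {r}) nz refl

Indep⇒lc-injective : ∀ {r m} {xs : Vec (V r) m} → Indep xs → ∀ c d → lc c xs ≡ lc d xs → c ≡ d
Indep⇒lc-injective {xs = xs} ind c d e = ⊕≡zero⇒≡ c d (ind (c ⊕ d) (begin
  lc (c ⊕ d) xs      ≡⟨ lc-⊕ c d xs ⟩
  lc c xs ⊕ lc d xs  ≡⟨ cong (_⊕ lc d xs) e ⟩
  lc d xs ⊕ lc d xs  ≡⟨ ⊕-self (lc d xs) ⟩
  zeroV              ∎))
  where open ≡-Reasoning

Indep-∷ : ∀ {r m} {xs : Vec (V r) m} {v : V r} → Indep xs → ¬ InSpan xs v → Indep (v ∷ xs)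
Indep-∷ {v = v} ind v∉ (true ∷ c)  e = ⊥-elim (v∉ (c , sym (⊕≡zero⇒≡ v _ e)))
Indep-∷         ind v∉ (false ∷ c) e = cong (false ∷_) (ind c (trans (sym (⊕-identityˡ _)) e))

unit : ∀ {m} → Fin m → Vec Bool m
unit zero    = true ∷ replicate _ false
unit (suc i) = false ∷ unit i

lc-unit : ∀ {r m} (i : Fin m) (xs : Vec (V r) m) → lc (unit i) xs ≡ lookup xs i
lc-unit zero    (x ∷ xs) = trans (cong (x ⊕_) (lc-zero xs)) (⊕-identityʳ x)
lc-unit (suc i) (x ∷ xs) = trans (⊕-identityˡ _) (lc-unit i xs)

unit≢zero : ∀ {m} (i : Fin m) → unit i ≢ replicate m false
unit≢zero zero    ()
unit≢zero (suc i) e = unit≢zero i (∷-injectiveʳ e)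

InSpan-lookup : ∀ {r m} (xs : Vec (V r) m) (i : Fin m) → InSpan xs (lookup xs i)
InSpan-lookup xs i = unit i , lc-unit i xs

Indep⇒nonzero : ∀ {r m} {xs : Vec (V r) m} → Indep xs → ∀ i → T (nonzero (lookup xs i))
Indep⇒nonzero {xs = xs} ind i =
  ≢zero⇒nonzero _ (λ e → unit≢zero i (ind (unit i) (trans (lc-unit i xs) e)))

InSpan? : ∀ {r m} (xs : Vec (V r) m) (v : V r) → Dec (InSpan xs v)
InSpan? [] v = map′ (λ e → [] , sym e) (λ { ([] , e) → sym e }) (≡-dec Bool._≟_ v zeroV)
InSpan? (x ∷ xs) v with InSpan? xs v | InSpan? xs (x ⊕ v)
... | yes (c , e) | _            = yes (false ∷ c , trans (⊕-identityˡ _) e)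
... | no _        | yes (c , e)  = yes (true ∷ c , trans (cong (x ⊕_) e) (⊕-cancelˡ x v))
... | no v∉       | no x⊕v∉      = no λ
  { (false ∷ c , e) → v∉ (c , trans (sym (⊕-identityˡ _)) e)
  ; (true ∷ c , e)  → x⊕v∉ (c , trans (sym (⊕-cancelˡ x _)) (cong (x ⊕_) e)) }

Vec-Bool↔Fin : ∀ n → Vec Bool n ↔ Fin (2 ^ n)
Vec-Bool↔Fin zero    = mk↔ₛ′ (λ _ → zero) (λ _ → []) (λ { zero → refl }) (λ { [] → refl })
Vec-Bool↔Fin (suc n) = ↔-sym *↔× ↔-∘ ((↔-sym 2↔Bool ×-↔ Vec-Bool↔Fin n) ↔-∘ uncons)
  where
  uncons : Vec Bool (suc n) ↔ (Bool × Vec Bool n)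
  uncons = mk↔ₛ′ (λ { (x ∷ v) → x , v }) (λ (x , v) → x ∷ v) (λ _ → refl) (λ { (x ∷ v) → refl })

2^n<2^1+n : ∀ n → 2 ^ n < 2 ^ suc n
2^n<2^1+n n = ℕ.^-monoʳ-< 2 (ℕ.n<1+n 1) (ℕ.n<1+n n)

¬Vec-Bool-suc↣ : ∀ k → ¬ (Vec Bool (suc k) ↣ Vec Bool k)
¬Vec-Bool-suc↣ k f = ℕ.<⇒≱ (2^n<2^1+n k) (injective⇒≤ (Injection.injective fin))
  where
  fin : Fin (2 ^ suc k) ↣ Fin (2 ^ k)
  fin = ↔⇒↣ (Vec-Bool↔Fin k) ↣-∘ (f ↣-∘ ↔⇒↣ (↔-sym (Vec-Bool↔Fin (suc k))))

-- Coordinates with respect to ys would inject GF(2)^(suc k) into GF(2)^k.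
inSpan⇒¬Indep : ∀ {r k} (xs : Vec (V r) (suc k)) (ys : Vec (V r) k) →
                (∀ i → InSpan ys (lookup xs i)) → ¬ Indep xs
inSpan⇒¬Indep xs ys xs⊆ ind = ¬Vec-Bool-suc↣ _ (mk↣ coords-inj)
  where
  ds = tabulate (proj₁ ∘ xs⊆)
  coords : Vec Bool (suc _) → Vec Bool _
  coords c = lc c ds
  ds-coords : map (λ d → lc d ys) ds ≡ xs
  ds-coords = begin
    map (λ d → lc d ys) ds                ≡⟨ tabulate-∘ (λ d → lc d ys) (proj₁ ∘ xs⊆) ⟨
    tabulate (λ i → lc (proj₁ (xs⊆ i)) ys) ≡⟨ tabulate-cong (proj₂ ∘ xs⊆) ⟩
    tabulate (lookup xs)                  ≡⟨ tabulate∘lookup xs ⟩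
    xs                                    ∎
    where open ≡-Reasoning
  coords-correct : ∀ c → lc (coords c) ys ≡ lc c xs
  coords-correct c = trans (lc-∘ c ds ys) (cong (lc c) ds-coords)
  coords-inj : Injective _≡_ _≡_ coords
  coords-inj {c} {d} e = Indep⇒lc-injective ind c d
    (trans (sym (coords-correct c)) (trans (cong (λ z → lc z ys) e) (coords-correct d)))

Indep⇒InSpan : ∀ {r} {xs : Vec (V r) r} → Indep xs → ∀ v → InSpan xs v
Indep⇒InSpan {r} {xs} ind v with InSpan? xs v
... | yes v∈ = v∈
... | no  v∉ = ⊥-elim (inSpan⇒¬Indep (v ∷ xs) (std r) (λ i → lookup (v ∷ xs) i , lc-std _)
                                     (Indep-∷ ind v∉))

-- v ∈₀ A says v ∈ A ∪ {0}; for a flat A this is the subspace spanned by A.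
infix 4 _∈₀_
_∈₀_ : ∀ {r} → V r → Subset r → Set
v ∈₀ A = (nz : T (nonzero v)) → T (A (v , nz))

Subset-cong : ∀ {r} (A : Subset r) {u v : V r} → u ≡ v →
              (p : T (nonzero u)) (q : T (nonzero v)) → A (u , p) ≡ A (v , q)
Subset-cong A refl p q = cong (λ nz → A (_ , nz)) (T-irrelevant p q)

∈₀-zero : ∀ {r} (A : Subset r) → zeroV ∈₀ A
∈₀-zero {r} A nz = ⊥-elim (¬nonzero-zeroV r nz)

∈⇒∈₀ : ∀ {r} (A : Subset r) {v : V r} {nz : T (nonzero v)} → T (A (v , nz)) → v ∈₀ A
∈⇒∈₀ A v∈A nz = subst T (Subset-cong A refl _ nz) v∈A

⊆⇒∈₀ : ∀ {r} {A B : Subset r} {v : V r} → A ⊆ B → v ∈₀ A → v ∈₀ B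
⊆⇒∈₀ A⊆B v∈A nz = A⊆B _ (v∈A nz)

module Flat {r k : ℕ} {A : Subset r} (flat : IsFlatOfRank r A k) where

  basis : Vec (V r) k
  basis = map proj₁ (proj₁ flat)

  InSpan⇒∈₀ : ∀ {v} → InSpan basis v → v ∈₀ A
  InSpan⇒∈₀ v∈ nz = Equivalence.from (proj₂ (proj₂ flat) (_ , nz)) v∈

  ∈₀⇒InSpan : ∀ {v} → v ∈₀ A → InSpan basis v
  ∈₀⇒InSpan {v} v∈A with ≡-dec Bool._≟_ v zeroV
  ... | yes refl = replicate k false , lc-zero basis
  ... | no  v≢0  = Equivalence.to (proj₂ (proj₂ flat) (v , nz)) (v∈A nz)
    where nz = ≢zero⇒nonzero v v≢0

  ⊕-closed : ∀ {u v} → u ∈₀ A → v ∈₀ A → u ⊕ v ∈₀ A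
  ⊕-closed u∈A v∈A with ∈₀⇒InSpan u∈A | ∈₀⇒InSpan v∈A
  ... | c , refl | d , refl = InSpan⇒∈₀ (c ⊕ d , lc-⊕ c d basis)

rank-suc⇒new-point : ∀ {r k} {A A′ : Subset r} → IsFlatOfRank r A k → IsFlatOfRank r A′ (suc k) →
             ∃ λ p → T (A′ p) × ¬ T (A p)
rank-suc⇒new-point {A = A} {A′} flat (B′ , B′-indep , B′-spans) with all? (λ i → T? (A (lookup B′ i)))
... | yes B′⊆A = ⊥-elim (inSpan⇒¬Indep (map proj₁ B′) (Flat.basis flat) B′-inSpan B′-indep)
  where
  B′-inSpan : ∀ i → InSpan (Flat.basis flat) (lookup (map proj₁ B′) i)
  B′-inSpan i rewrite lookup-map i proj₁ B′ = Flat.∈₀⇒InSpan flat (∈⇒∈₀ A (B′⊆A i))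
... | no B′⊈A with ¬∀⟶∃¬ _ _ (λ i → T? (A (lookup B′ i))) B′⊈A
... | i , i∉A = lookup B′ i , Equivalence.from (B′-spans (lookup B′ i)) i∈span , i∉A
  where
  i∈span : InSpan (map proj₁ B′) (proj₁ (lookup B′ i))
  i∈span = subst (InSpan (map proj₁ B′)) (lookup-map i proj₁ B′) (InSpan-lookup (map proj₁ B′) i)

Indep⇒IsFlatOfRank : ∀ {r k} {A : Subset r} (U : Vec (V r) k) → Indep U →
                     (∀ p → T (A p) ⇔ InSpan U (proj₁ p)) → IsFlatOfRank r A k
Indep⇒IsFlatOfRank {r} {A = A} U U-indep U-spans = points , subst Indep (sym U≡) U-indep ,
  λ p → subst (λ W → T (A p) ⇔ InSpan W (proj₁ p)) (sym U≡) (U-spans p)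
  where
  point : _ → Point r
  point i = lookup U i , Indep⇒nonzero U-indep i
  points = tabulate point
  U≡ : map proj₁ points ≡ U
  U≡ = trans (sym (tabulate-∘ proj₁ point)) (tabulate∘lookup U)

Elem-≡ : ∀ {r} (G : Subset r) {x y : Elem G} → vec x ≡ vec y → x ≡ y
Elem-≡ G {(v , p) , t} {(.v , p′) , t′} refl with T-irrelevant p p′
... | refl = cong ((v , p) ,_) (T-irrelevant t t′)

Indep-cong : ∀ {r m} {xs ys : Vec (V r) m} → xs ≡ ys → Indep xs ⇔ Indep ys
Indep-cong refl = ⇔-id _

Linear : ∀ {r s} → (V r → V s) → Set
Linear L = ∀ {m} (c : Vec Bool m) xs → lc c (map L xs) ≡ L (lc c xs)

Indep-map : ∀ {r s m} {L : V r → V s} → Linear L → (∀ v → L v ≡ zeroV → v ≡ zeroV) →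
            (xs : Vec (V r) m) → Indep xs ⇔ Indep (map L xs)
Indep-map {L = L} L-linear L-ker xs = mk⇔
  (λ ind c e → ind c (L-ker _ (trans (sym (L-linear c xs)) e)))
  (λ ind c e → ind c (trans (L-linear c xs) (trans (cong L e) (sym (L-linear [] [])))))

iso-refl : ∀ {r} (G : Subset r) → Isomorphic r G r G
iso-refl G = ↔-id (Elem G) , λ _ _ → ⇔-id _

iso-sym : ∀ {r s} {G : Subset r} {H : Subset s} → Isomorphic r G s H → Isomorphic s H r G
iso-sym (φ , φ-indep) = ↔-sym φ , λ m ys →
  ⇔-sym (Indep-cong (trans (sym (map-∘ _ _ ys)) (map-cong (cong vec ∘ Inverse.strictlyInverseˡ φ) ys))
         ⇔-∘ (φ-indep m (map (Inverse.from φ) ys) ⇔-∘ Indep-cong (map-∘ vec (Inverse.from φ) ys)))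

iso-trans : ∀ {r s t} {G : Subset r} {H : Subset s} {K : Subset t} →
            Isomorphic r G s H → Isomorphic s H t K → Isomorphic r G t K
iso-trans (φ , φ-indep) (ψ , ψ-indep) = ψ ↔-∘ φ , λ m xs →
  Indep-cong (sym (map-∘ _ (Inverse.to φ) xs)) ⇔-∘ (ψ-indep m (map (Inverse.to φ) xs)
    ⇔-∘ (Indep-cong (map-∘ vec (Inverse.to φ) xs) ⇔-∘ φ-indep m xs))

linear⇒Isomorphic : ∀ {r s} {G : Subset r} {H : Subset s} (φ : Elem G ↔ Elem H) {L : V r → V s} →
                    (∀ x → vec (Inverse.to φ x) ≡ L (vec x)) → Linear L →
                    (∀ v → L v ≡ zeroV → v ≡ zeroV) → Isomorphic r G s H
linear⇒Isomorphic φ {L} φ≗L L-linear L-ker = φ , λ m xs →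
  Indep-cong (trans (sym (map-∘ L vec xs)) (map-cong (sym ∘ φ≗L) xs))
    ⇔-∘ Indep-map L-linear L-ker (map vec xs)

HasSize-iso : ∀ {r s n} {G : Subset r} {H : Subset s} → Isomorphic r G s H → HasSize H n → HasSize G n
HasSize-iso (φ , _) H-size = H-size ↔-∘ φ

-- Vectors list their coordinates from the top, so colour σ v is the entry of σ at the
-- leading nonzero coordinate of v.
colour : ∀ {r} → Vec Bool r → V r → Bool
colour []      []      = false
colour (b ∷ σ) (x ∷ v) = if x then b else colour σ v

Canonical : ∀ {r} → Vec Bool r → Subset r
Canonical σ p = colour σ (proj₁ p)

¬T⇒≡false : ∀ {b} → ¬ T b → b ≡ false
¬T⇒≡false {false} _  = refl
¬T⇒≡false {true}  ¬t = ⊥-elim (¬t tt)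

MonochromeLayer : ∀ {r} → Subset r → Subset r → Subset r → Set
MonochromeLayer G X Y = ∃ λ β → ∀ p → T (Y p) → ¬ T (X p) → G p ≡ β

LayerInG⊎R : ∀ {r} → Subset r → Subset r → Subset r → Set
LayerInG⊎R G X Y =
  (∀ p → T (Y p) → ¬ T (X p) → T (G p)) ⊎ (∀ p → T (Y p) → ¬ T (X p) → ¬ T (G p))

LayerInG⊎R⇔MonochromeLayer : ∀ {r} {G X Y : Subset r} → LayerInG⊎R G X Y ⇔ MonochromeLayer G X Y
LayerInG⊎R⇔MonochromeLayer = mk⇔
  (λ { (inj₁ ⊆G) → true  , λ p y ¬x → Equivalence.to T-≡ (⊆G p y ¬x)
     ; (inj₂ ⊆R) → false , λ p y ¬x → ¬T⇒≡false (⊆R p y ¬x) })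
  (λ { (true  , ≡β) → inj₁ λ p y ¬x → subst T (sym (≡β p y ¬x)) tt
     ; (false , ≡β) → inj₂ λ p y ¬x → subst T (≡β p y ¬x) })

record TargetFlag {r : ℕ} (G : Subset r) : Set where
  field
    F      : ℕ → Subset r
    flat   : ∀ {k} → k ≤ r → IsFlatOfRank r (F k) k
    nested : ∀ {k} → k < r → F k ⊆ F (suc k)
    layer  : ∀ {k} → k < r → MonochromeLayer G (F k) (F (suc k))

clamp : ∀ r → ℕ → Fin (suc r)
clamp r       zero    = zero
clamp zero    (suc k) = zero
clamp (suc r) (suc k) = suc (clamp r k)

toℕ-clamp : ∀ {r k} → k ≤ r → toℕ (clamp r k) ≡ k
toℕ-clamp z≤n       = refl
toℕ-clamp (s≤s k≤r) = cong suc (toℕ-clamp k≤r)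

inject₁-clamp : ∀ {r k} → k ≤ r → inject₁ (clamp r k) ≡ clamp (suc r) k
inject₁-clamp z≤n       = refl
inject₁-clamp (s≤s k≤r) = cong suc (inject₁-clamp k≤r)

clamp-step : ∀ {r k} → k < r →
             ∃ λ (i : Fin r) → inject₁ i ≡ clamp r k × suc i ≡ clamp r (suc k)
clamp-step {suc r} {k} (s≤s k≤r) = clamp r k , inject₁-clamp k≤r , refl

IsProjectiveTarget⇒TargetFlag : ∀ {r} {G : Subset r} → IsProjectiveTarget r G → TargetFlag G
IsProjectiveTarget⇒TargetFlag {r} {G} (F , flat , nested , layer) = record
  { F      = F ∘ clamp r
  ; flat   = λ k≤r → subst (IsFlatOfRank r _) (toℕ-clamp k≤r) (flat (clamp r _))
  ; nested = λ k<r → at-step k<r (λ X Y → X ⊆ Y) (nested _)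
  ; layer  = λ k<r → at-step k<r (MonochromeLayer G)
                               (Equivalence.to LayerInG⊎R⇔MonochromeLayer (layer _))
  }
  where
  at-step : ∀ {k} → k < r → (P : Subset r → Subset r → Set) →
            (∀ {i} → P (F (inject₁ i)) (F (suc i))) → P (F (clamp r k)) (F (clamp r (suc k)))
  at-step k<r P P-step with clamp-step k<r
  ... | i , i≡k , suc-i≡suc-k = subst₂ P (cong F i≡k) (cong F suc-i≡suc-k) P-step

TargetFlag⇒IsProjectiveTarget : ∀ {r} {G : Subset r} → TargetFlag G → IsProjectiveTarget r G
TargetFlag⇒IsProjectiveTarget {r} {G} flag =
  F ∘ toℕ , (λ j → flat (ℕ.≤-pred (toℕ<n j))) , nested′ , layer′
  where
  open TargetFlag flag
  nested′ : ∀ (i : Fin r) → F (toℕ (inject₁ i)) ⊆ F (suc (toℕ i))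
  nested′ i rewrite toℕ-inject₁ i = nested (toℕ<n i)
  layer′ : ∀ (i : Fin r) → LayerInG⊎R G (F (toℕ (inject₁ i))) (F (suc (toℕ i)))
  layer′ i rewrite toℕ-inject₁ i = Equivalence.from LayerInG⊎R⇔MonochromeLayer (layer (toℕ<n i))

module _ {r : ℕ} {G : Subset r} (flag : TargetFlag G) where
  open TargetFlag flag

  record AdaptedBasis (k : ℕ) : Set where
    field
      basis    : Vec (V r) k
      colours  : Vec Bool k
      indep    : Indep basis
      spans-F  : ∀ c → lc c basis ∈₀ F k
      coloured : ∀ c (nz : T (nonzero (lc c basis))) → G (lc c basis , nz) ≡ colour colours c

  empty-basis : AdaptedBasis 0
  empty-basis = record
    { basis = [] ; colours = [] ; indep = λ { [] _ → refl }
    ; spans-F = λ { [] → ∈₀-zero (F 0) } ; coloured = λ { [] nz → ⊥-elim (¬nonzero-zeroV r nz) } }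

  -- b is any point of F (suc k) − F k; every combination involving b lies in that layer,
  -- hence has its colour β.
  extend : ∀ {k} → k < r → AdaptedBasis k → AdaptedBasis (suc k)
  extend {k} k<r ab = record
    { basis = b ∷ basis ; colours = β ∷ colours
    ; indep = indep′ ; spans-F = spans-F′ ; coloured = coloured′ }
    where
    open AdaptedBasis ab
    flatₖ = flat (ℕ.<⇒≤ k<r)
    new = rank-suc⇒new-point flatₖ (flat k<r)
    b = proj₁ (proj₁ new)
    b∈F′ : b ∈₀ F (suc k)
    b∈F′ = ∈⇒∈₀ (F (suc k)) (proj₁ (proj₂ new))
    b∉F : ¬ b ∈₀ F k
    b∉F b∈F = proj₂ (proj₂ new) (b∈F _)
    β = proj₁ (layer k<r)

    spans-F′ : ∀ c → lc c (b ∷ basis) ∈₀ F (suc k)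
    spans-F′ (x ∷ c) = Flat.⊕-closed (flat k<r) (x·b∈F′ x) (⊆⇒∈₀ (nested k<r) (spans-F c))
      where
      x·b∈F′ : ∀ x → x · b ∈₀ F (suc k)
      x·b∈F′ false = ∈₀-zero (F (suc k))
      x·b∈F′ true  = b∈F′

    indep′ : Indep (b ∷ basis)
    indep′ (true ∷ c)  e = ⊥-elim (b∉F (subst (_∈₀ F k) (sym (⊕≡zero⇒≡ b _ e)) (spans-F c)))
    indep′ (false ∷ c) e = cong (false ∷_) (indep c (trans (sym (⊕-identityˡ _)) e))

    coloured′ : ∀ c (nz : T (nonzero (lc c (b ∷ basis)))) →
                G (lc c (b ∷ basis) , nz) ≡ colour (β ∷ colours) c
    coloured′ (false ∷ c) nz = trans (Subset-cong G (⊕-identityˡ (lc c basis)) nz nz′) (coloured c nz′)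
      where nz′ = subst (T ∘ nonzero) (⊕-identityˡ (lc c basis)) nz
    coloured′ (true ∷ c) nz = proj₂ (layer k<r) _ (spans-F′ (true ∷ c) nz) ∉F
      where
      ∉F : ¬ T (F k (b ⊕ lc c basis , nz))
      ∉F v∈F = b∉F (subst (_∈₀ F k) (⊕-cancelʳ (lc c basis) b)
                     (Flat.⊕-closed flatₖ (∈⇒∈₀ (F k) v∈F) (spans-F c)))

  adapted-basis : ∀ {k} → k ≤ r → AdaptedBasis k
  adapted-basis {zero}  _   = empty-basis
  adapted-basis {suc k} k<r = extend k<r (adapted-basis (ℕ.<⇒≤ k<r))

  TargetFlag⇒≅Canonical : ∃ λ σ → Isomorphic r (Canonical σ) r G
  TargetFlag⇒≅Canonical =
    colours , linear⇒Isomorphic φ (λ _ → refl) (λ c ys → sym (lc-∘ c ys basis)) indep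
    where
    open AdaptedBasis (adapted-basis ℕ.≤-refl)
    L : V r → V r
    L c = lc c basis
    coords : ∀ v → InSpan basis v
    coords = Indep⇒InSpan indep
    L-nonzero : ∀ c → T (nonzero c) → T (nonzero (L c))
    L-nonzero c nz = ≢zero⇒nonzero (L c) (nonzero⇒≢zero c nz ∘ indep c)
    to : Elem (Canonical colours) → Elem G
    to ((c , nz) , c∈) = (L c , L-nonzero c nz) , subst T (sym (coloured c _)) c∈
    from : Elem G → Elem (Canonical colours)
    from ((v , nz) , v∈) = (c , c-nonzero) , subst T same-colour v∈
      where
      c = proj₁ (coords v)
      e = proj₂ (coords v)
      c-nonzero = ≢zero⇒nonzero c λ c≡0 →
        nonzero⇒≢zero v nz (trans (sym e) (trans (cong L c≡0) (lc-zero basis)))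
      same-colour = trans (Subset-cong G (sym e) nz (L-nonzero c c-nonzero)) (coloured c _)
    φ : Elem (Canonical colours) ↔ Elem G
    φ = mk↔ₛ′ to from
          (λ y → Elem-≡ G (proj₂ (coords (vec y))))
          (λ x → Elem-≡ (Canonical colours) (Indep⇒lc-injective indep _ _ (proj₂ (coords (L (vec x))))))

level : ∀ {r} → V r → ℕ
level []                 = 0
level {suc r} (true ∷ v) = suc r
level (false ∷ v)        = level v

level≤ : ∀ {r} (v : V r) → level v ≤ r
level≤ []          = z≤n
level≤ (true ∷ v)  = ℕ.≤-refl
level≤ (false ∷ v) = ℕ.m≤n⇒m≤1+n (level≤ v)

digit : ∀ {r} → Vec Bool r → ℕ → Bool
digit []              ℓ = false
digit {suc r} (b ∷ σ) ℓ = if ℓ ≡ᵇ suc r then b else digit σ ℓ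

colour≡digit : ∀ {r} (σ v : Vec Bool r) → colour σ v ≡ digit σ (level v)
colour≡digit []      []          = refl
colour≡digit {suc r} (b ∷ σ) (true ∷ v) rewrite Equivalence.to T-≡ (ℕ.≡⇒≡ᵇ r r refl) = refl
colour≡digit {suc r} (b ∷ σ) (false ∷ v) with level v ≡ᵇ suc r in eq
... | false = colour≡digit σ v
... | true  = ⊥-elim (ℕ.<-irrefl (ℕ.≡ᵇ⇒≡ _ _ (subst T (sym eq) tt)) (s≤s (level≤ v)))

units : ∀ {k r} → k ≤′ r → Vec (V r) k
units ≤′-refl        = std _
units (≤′-step k≤r) = map (false ∷_) (units k≤r)

units-indep : ∀ {k r} (k≤r : k ≤′ r) → Indep (units k≤r)
units-indep ≤′-refl       c e = trans (sym (lc-std c)) e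
units-indep (≤′-step k≤r) c e = units-indep k≤r c (∷-injectiveʳ (trans (sym (lc-map-false∷ c _)) e))

units-span : ∀ {k r} (k≤r : k ≤′ r) (v : V r) → InSpan (units k≤r) v ⇔ level v ≤ k
units-span ≤′-refl v = mk⇔ (λ _ → level≤ v) (λ _ → v , lc-std v)
units-span {k} (≤′-step k≤r) (true ∷ v) = mk⇔
  (λ (c , e) → contradiction (∷-injectiveˡ (trans (sym (lc-map-false∷ c _)) e)) λ ())
  (λ r<k → ⊥-elim (ℕ.<⇒≱ (s≤s (ℕ.≤′⇒≤ k≤r)) r<k))
units-span (≤′-step k≤r) (false ∷ v) = units-span k≤r v ⇔-∘ mk⇔
  (λ (c , e) → c , ∷-injectiveʳ (trans (sym (lc-map-false∷ c _)) e))
  (λ (c , e) → c , trans (lc-map-false∷ c _) (cong (false ∷_) e))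

Level≤ : ∀ {r} → ℕ → Subset r
Level≤ k p = level (proj₁ p) ≤ᵇ k

Level≤-flat : ∀ {r k} → k ≤ r → IsFlatOfRank r (Level≤ k) k
Level≤-flat {k = k} k≤r = Indep⇒IsFlatOfRank (units k≤′r) (units-indep k≤′r) λ p →
  ⇔-sym (units-span k≤′r (proj₁ p)) ⇔-∘ mk⇔ (ℕ.≤ᵇ⇒≤ (level (proj₁ p)) k) ℕ.≤⇒≤ᵇ
  where k≤′r = ℕ.≤⇒≤′ k≤r

canonical-flag : ∀ {r} (σ : Vec Bool r) → TargetFlag (Canonical σ)
canonical-flag σ = record
  { F      = Level≤
  ; flat   = Level≤-flat
  ; nested = λ {k} _ p ≤k → ℕ.≤⇒≤ᵇ (ℕ.m≤n⇒m≤1+n (ℕ.≤ᵇ⇒≤ (level (proj₁ p)) k ≤k))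
  ; layer  = λ {k} _ → digit σ (suc k) , λ p ≤1+k ≰k →
      trans (colour≡digit σ (proj₁ p)) (cong (digit σ) (level≡ p ≤1+k ≰k))
  }
  where
  level≡ : ∀ {k} p → T (Level≤ (suc k) p) → ¬ T (Level≤ k p) → level (proj₁ p) ≡ suc k
  level≡ {k} p ≤1+k ≰k = ℕ.≤-antisym (ℕ.≤ᵇ⇒≤ (level (proj₁ p)) (suc k) ≤1+k) (ℕ.≰⇒> (≰k ∘ ℕ.≤⇒≤ᵇ))

value : ∀ {r} → Vec Bool r → ℕ
value []              = 0
value {suc r} (b ∷ σ) = (if b then 2 ^ r else 0) + value σ

Coloured : ∀ {r} → Vec Bool r → Set
Coloured σ = Σ (V _) (T ∘ colour σ)

colour⇒nonzero : ∀ {r} (σ v : Vec Bool r) → T (colour σ v) → T (nonzero v)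
colour⇒nonzero []      []          ()
colour⇒nonzero (b ∷ σ) (true ∷ v)  _ = tt
colour⇒nonzero (b ∷ σ) (false ∷ v) t = colour⇒nonzero σ v t

Elem↔Coloured : ∀ {r} (σ : Vec Bool r) → Elem (Canonical σ) ↔ Coloured σ
Elem↔Coloured σ = mk↔ₛ′ (λ ((v , _) , t) → v , t) (λ (v , t) → (v , colour⇒nonzero σ v t) , t)
                        (λ _ → refl) (λ _ → Elem-≡ (Canonical σ) refl)

Coloured-false∷ : ∀ {r} (σ : Vec Bool r) → Coloured (false ∷ σ) ↔ Coloured σ
Coloured-false∷ σ = mk↔ₛ′ (λ { (false ∷ v , t) → v , t }) (λ (v , t) → false ∷ v , t)
                          (λ _ → refl) (λ { (false ∷ v , t) → refl })

Coloured-true∷ : ∀ {r} (σ : Vec Bool r) → Coloured (true ∷ σ) ↔ (Vec Bool r ⊎ Coloured σ)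
Coloured-true∷ σ = mk↔ₛ′ to from (λ { (inj₁ v) → refl ; (inj₂ _) → refl })
                         (λ { (true ∷ v , tt) → refl ; (false ∷ v , t) → refl })
  where
  to : Coloured (true ∷ σ) → _
  to (true ∷ v , _)  = inj₁ v
  to (false ∷ v , t) = inj₂ (v , t)
  from : _ → Coloured (true ∷ σ)
  from (inj₁ v)       = true ∷ v , tt
  from (inj₂ (v , t)) = false ∷ v , t

Coloured↔Fin : ∀ {r} (σ : Vec Bool r) → Coloured σ ↔ Fin (value σ)
Coloured↔Fin []              = mk↔ₛ′ (λ { ([] , ()) }) (λ ()) (λ ()) (λ { ([] , ()) })
Coloured↔Fin (false ∷ σ)     = Coloured↔Fin σ ↔-∘ Coloured-false∷ σ
Coloured↔Fin {suc r} (true ∷ σ) =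
  ↔-sym (+↔⊎ {2 ^ r}) ↔-∘ ((Vec-Bool↔Fin r ⊎-↔ Coloured↔Fin σ) ↔-∘ Coloured-true∷ σ)

Canonical-size : ∀ {r} (σ : Vec Bool r) → HasSize (Canonical σ) (value σ)
Canonical-size σ = Coloured↔Fin σ ↔-∘ Elem↔Coloured σ

Canonical-false∷ : ∀ {r} (σ : Vec Bool r) → Isomorphic r (Canonical σ) (suc r) (Canonical (false ∷ σ))
Canonical-false∷ σ = linear⇒Isomorphic φ (λ _ → refl) lc-map-false∷ (λ _ → ∷-injectiveʳ)
  where
  φ = ↔-sym (Elem↔Coloured (false ∷ σ)) ↔-∘ (↔-sym (Coloured-false∷ σ) ↔-∘ Elem↔Coloured σ)

value<2^ : ∀ {r} (σ : Vec Bool r) → value σ < 2 ^ r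
value<2^ []              = s≤s z≤n
value<2^ {suc r} (false ∷ σ) = ℕ.<-trans (value<2^ σ) (2^n<2^1+n r)
value<2^ {suc r} (true ∷ σ)  = ℕ.+-monoʳ-< (2 ^ r) (ℕ.<-≤-trans (value<2^ σ) (ℕ.m≤m+n (2 ^ r) 0))

2^≤value-true∷ : ∀ {r} (σ : Vec Bool r) → 2 ^ r ≤ value (true ∷ σ)
2^≤value-true∷ {r} σ = ℕ.m≤m+n (2 ^ r) (value σ)

value-injective : ∀ {r} (σ σ′ : Vec Bool r) → value σ ≡ value σ′ → σ ≡ σ′
value-injective []      []        _ = refl
value-injective {suc r} (true ∷ σ) (true ∷ σ′) e =
  cong (true ∷_) (value-injective σ σ′ (ℕ.+-cancelˡ-≡ (2 ^ r) _ _ e))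
value-injective (false ∷ σ) (false ∷ σ′) e = cong (false ∷_) (value-injective σ σ′ e)
value-injective (true ∷ σ)  (false ∷ σ′) e =
  ⊥-elim (ℕ.<⇒≱ (value<2^ σ′) (subst (_ ≤_) e (2^≤value-true∷ σ)))
value-injective (false ∷ σ) (true ∷ σ′)  e =
  ⊥-elim (ℕ.<⇒≱ (value<2^ σ) (subst (_ ≤_) (sym e) (2^≤value-true∷ σ′)))

value-true∷>0 : ∀ {r} (σ : Vec Bool r) → 0 < value (true ∷ σ)
value-true∷>0 {r} σ = ℕ.<-≤-trans (ℕ.m^n>0 2 r) (2^≤value-true∷ σ)

value-true∷-< : ∀ {r r′} (σ : Vec Bool r) (σ′ : Vec Bool r′) → r < r′ →
                value (true ∷ σ) < value (true ∷ σ′)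
value-true∷-< σ σ′ r<r′ =
  ℕ.<-≤-trans (value<2^ (true ∷ σ)) (ℕ.≤-trans (ℕ.^-monoʳ-≤ 2 r<r′) (2^≤value-true∷ σ′))

-- Leading zeros are stripped by Canonical-false∷; between vectors with a leading one,
-- the value determines the length and then the vector.
≡value⇒Isomorphic : ∀ {r s} (σ : Vec Bool r) (τ : Vec Bool s) → value σ ≡ value τ →
                    Isomorphic r (Canonical σ) s (Canonical τ)
≡value⇒Isomorphic (false ∷ σ) τ e = iso-trans (iso-sym (Canonical-false∷ σ)) (≡value⇒Isomorphic σ τ e)
≡value⇒Isomorphic σ (false ∷ τ) e = iso-trans (≡value⇒Isomorphic σ τ e) (Canonical-false∷ τ)
≡value⇒Isomorphic []         []         _ = iso-refl _
≡value⇒Isomorphic []         (true ∷ τ) e = ⊥-elim (ℕ.<-irrefl e (value-true∷>0 τ))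
≡value⇒Isomorphic (true ∷ σ) []         e = ⊥-elim (ℕ.<-irrefl (sym e) (value-true∷>0 σ))
≡value⇒Isomorphic {suc r} {suc s} (true ∷ σ) (true ∷ τ) e with ℕ.<-cmp r s
... | tri< r<s _ _ = ⊥-elim (ℕ.<-irrefl e (value-true∷-< σ τ r<s))
... | tri> _ _ s<r = ⊥-elim (ℕ.<-irrefl (sym e) (value-true∷-< τ σ s<r))
... | tri≈ _ refl _ rewrite value-injective (true ∷ σ) (true ∷ τ) e = iso-refl _

binary : ∀ r m → m < 2 ^ r → ∃ λ (σ : Vec Bool r) → value σ ≡ m
binary zero    zero    _ = [] , refl
binary zero    (suc m) (s≤s ())
binary (suc r) m m<2^1+r with m ℕ.<? 2 ^ r
... | yes m<2^r = let σ , e = binary r m m<2^r in false ∷ σ , e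
... | no  m≮2^r = true ∷ σ , trans (cong (2 ^ r +_) e) (ℕ.m+[n∸m]≡n 2^r≤m)
  where
  2^r≤m = ℕ.≮⇒≥ m≮2^r
  m∸2^r<2^r : m ∸ 2 ^ r < 2 ^ r
  m∸2^r<2^r = subst (m ∸ 2 ^ r <_) (trans (ℕ.m+n∸m≡n (2 ^ r) (2 ^ r + 0)) (ℕ.+-identityʳ _))
                    (ℕ.∸-monoˡ-< m<2^1+r 2^r≤m)
  σ = proj₁ (binary r (m ∸ 2 ^ r) m∸2^r<2^r)
  e = proj₂ (binary r (m ∸ 2 ^ r) m∸2^r<2^r)

n<2^n : ∀ n → n < 2 ^ n
n<2^n zero    = s≤s z≤n
n<2^n (suc n) = ℕ.≤-<-trans (n<2^n n) (2^n<2^1+n n)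

IsProjectiveTarget⇒≅Canonical : ∀ {r} {G : Subset r} → IsProjectiveTarget r G →
                                 ∃ λ (σ : Vec Bool r) → Isomorphic r (Canonical σ) r G
IsProjectiveTarget⇒≅Canonical = TargetFlag⇒≅Canonical ∘ IsProjectiveTarget⇒TargetFlag

≅Canonical⇒value≡size : ∀ {r n} {G : Subset r} (σ : Vec Bool r) →
                        Isomorphic r (Canonical σ) r G → HasSize G n → value σ ≡ n
≅Canonical⇒value≡size σ σ≅G G-size = ↔⇒≡ (HasSize-iso σ≅G G-size ↔-∘ ↔-sym (Canonical-size σ))

corollary3p8 : ∀ (n : ℕ) →
      (Σ ℕ λ r → Σ (Subset r) λ G → IsProjectiveTarget r G × HasSize G n)
    × (∀ (r s : ℕ) (G : Subset r) (H : Subset s) →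
         IsProjectiveTarget r G → HasSize G n →
         IsProjectiveTarget s H → HasSize H n →
         Isomorphic r G s H)
corollary3p8 n = existence , uniqueness
  where
  existence : Σ ℕ λ r → Σ (Subset r) λ G → IsProjectiveTarget r G × HasSize G n
  existence with binary n n (n<2^n n)
  ... | σ , value≡n = n , Canonical σ , TargetFlag⇒IsProjectiveTarget (canonical-flag σ)
                    , subst (HasSize (Canonical σ)) value≡n (Canonical-size σ)

  uniqueness : ∀ (r s : ℕ) (G : Subset r) (H : Subset s) →
               IsProjectiveTarget r G → HasSize G n → IsProjectiveTarget s H → HasSize H n →
               Isomorphic r G s H
  uniqueness r s G H G-target G-size H-target H-size
    with σ , σ≅G ← IsProjectiveTarget⇒≅Canonical G-target
       | τ , τ≅H ← IsProjectiveTarget⇒≅Canonical H-target =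
    iso-trans (iso-sym σ≅G) (iso-trans (≡value⇒Isomorphic σ τ value-eq) τ≅H)
    where value-eq = trans (≅Canonical⇒value≡size σ σ≅G G-size) (sym (≅Canonical⇒value≡size τ τ≅H H-size))
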